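{- Let $n\ge2$ and let $\mathcal F\subseteq\mathcal P([n])$ be $\mathcal N$-saturated. Then there exists an $\mathcal N$-saturated family $\mathcal F'\subseteq\mathcal P([n])$ with $|\mathcal F'|=|\mathcal F|$ having a component $\mathcal G'$ that contains a set $M'\in\mathcal G'$ with $|M'|\le n/2$ which is comparable (under inclusion) to every element of $\mathcal G'$.
   Context: $[n]=\{1,\dots,n\}$, $\mathcal P([n])$ its power set ordered by inclusion. The poset $\mathcal N$ has four elements $a,b,c,d$ with $a<c$, $b<c$, $b<d$ and no other comparabilities. A family contains an induced copy of $\mathcal N$ if it contains distinct sets $P,Q,R,S$ with $P\subset R$, $Q\subset R$, $Q\subset S$ and each of the pairs $\{P,Q\},\{P,S\},\{R,S\}$ incomparable. $\mathcal F$ is $\mathcal N$-saturated if it contains no induced copy of $\mathcal N$ but $\mathcal F\cup\{X\}$ contains one for every $X\in\mathcal P([n])\setminus\mathcal F$. A component of a family $\mathcal F$ is the vertex set of a connected component of the Hasse diagram of $(\mathcal F\setminus\{\emptyset,[n]\},\subseteq)$ viewed as an undirected graph. -}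

module Defs where

open import Data.Nat using (ℕ; zero; suc; _*_; _≤_)
open import Data.Bool using (Bool; true; false; _∨_; if_then_else_)
open import Data.Bool.Properties using () renaming (_≟_ to _≟ᵇ_)
open import Data.Vec using (Vec; []; _∷_)
open import Data.Vec.Properties using (≡-dec)
open import Data.Fin.Subset using (Subset; _⊆_; _⊂_; ⊥; ⊤; ∣_∣; inside; outside)
open import Data.List using (List; []; _∷_; map; _++_; length; filter)
open import Data.Product using (Σ; ∃; _×_; _,_)
open import Data.Sum using (_⊎_)
open import Relation.Nullary using (¬_; does)
open import Relation.Binary.PropositionalEquality using (_≡_; _≢_)
open import Relation.Binary.Construct.Closure.ReflexiveTransitive using (Star)

Family : ℕ → Set
Family n = Subset n → Bool

_∈F_ : ∀ {n} → Subset n → Family n → Set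
X ∈F F = F X ≡ true

_≟S_ : ∀ {n} (X Y : Subset n) → Relation.Nullary.Dec (X ≡ Y)
_≟S_ = ≡-dec _≟ᵇ_

allSubsets : (n : ℕ) → List (Subset n)
allSubsets zero = [] ∷ []
allSubsets (suc n) = map (inside ∷_) (allSubsets n) ++ map (outside ∷_) (allSubsets n)

card : ∀ {n} → Family n → ℕ
card {n} F = length (filter (λ X → F X Data.Bool.≟ true) (allSubsets n))

insert : ∀ {n} → Subset n → Family n → Family n
insert X F Y = F Y ∨ does (Y ≟S X)

Incomparable : ∀ {n} → Subset n → Subset n → Set
Incomparable X Y = ¬ (X ⊆ Y) × ¬ (Y ⊆ X)

Comparable : ∀ {n} → Subset n → Subset n → Set
Comparable X Y = X ⊆ Y ⊎ Y ⊆ X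

ContainsN : ∀ {n} → Family n → Set
ContainsN {n} F = Σ (Subset n) λ P → Σ (Subset n) λ Q → Σ (Subset n) λ R → Σ (Subset n) λ S →
  (P ∈F F × Q ∈F F × R ∈F F × S ∈F F) ×
  (P ≢ Q × P ≢ R × P ≢ S × Q ≢ R × Q ≢ S × R ≢ S) ×
  (P ⊂ R × Q ⊂ R × Q ⊂ S) ×
  (Incomparable P Q × Incomparable P S × Incomparable R S)

NSaturated : ∀ {n} → Family n → Set
NSaturated {n} F = ¬ ContainsN F × ((X : Subset n) → F X ≡ false → ContainsN (insert X F))

Inner : ∀ {n} → Family n → Subset n → Set
Inner F X = X ∈F F × X ≢ ⊥ × X ≢ ⊤

Covers : ∀ {n} → Family n → Subset n → Subset n → Set
Covers {n} F X Y = Inner F X × Inner F Y × X ⊂ Y ×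
  ((Z : Subset n) → Inner F Z → X ⊂ Z → ¬ (Z ⊂ Y))

HasseEdge : ∀ {n} → Family n → Subset n → Subset n → Set
HasseEdge F X Y = Covers F X Y ⊎ Covers F Y X

Connected : ∀ {n} → Family n → Subset n → Subset n → Set
Connected F = Star (HasseEdge F)

IsComponent : ∀ {n} → Family n → (Subset n → Set) → Set
IsComponent {n} F G = Σ (Subset n) λ X → Inner F X ×
  ((Y : Subset n) → (G Y → Connected F X Y) × (Connected F X Y → G Y))

{-# OPTIONS --safe #-}
-- Call T comparability-closed in F if every inner set (a member of F other than ∅ and [n])
-- that is comparable to an inner set comparable to T is itself comparable to T. Hasse edges
-- join comparable sets, so such a T is comparable to its whole component; and a closed T
-- cannot complete an induced N, so saturation puts it into F.
--
-- A closed inner set exists. Take a minimal inner set a and let T be maximal among the sets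
-- containing a, comparable to every inner superset of a and contained in one of them. The
-- inner sets lying below some inner superset of a are closed under comparability, since an
-- escape would form an N with a; and each such set W is comparable to T, since otherwise
-- the meet of the inner supersets of a containing T ∪ W would be a larger candidate (again
-- because F has no N).
--
-- If 2|T| > n, pass to {∁X : X ∈ F}: N is self-dual, so this family is again N-saturated;
-- it has the same size, and ∁T is closed in it with 2|∁T| < n.
module Submission where

open import Defs
open import Algebra.Lattice.Properties.BooleanAlgebra as BooleanAlgebra using ()
open import Data.Bool using (Bool; true; false; _∨_) renaming (_≟_ to _≟ᵇ_)
open import Data.Empty using (⊥-elim)
open import Data.Fin using (zero)
open import Data.Fin.Properties using (¬∀⟶∃¬)
open import Data.Fin.Subset using (Subset; ∣_∣; _⊆_; _⊂_; _∈_; _∪_; ∁; ⊥; ⊤; ⁅_⁆; inside; outside)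
open import Data.Fin.Subset.Properties
  using ( _⊆?_; _⊂?_; _∈?_; anySubset?; ⊆-refl; ⊆-reflexive; ⊆-trans; ⊆-antisym; ⊥⊆; ⊆⊤
        ; p⊆p∪q; q⊆p∪q; x∈p∪q⁻; p⊂q⇒∣p∣<∣q∣; p⊂q⇒∁p⊃∁q; p⊆q⇒∁p⊇∁q; ∁p⊆∁q⇒p⊇q
        ; x∉∁p⇒x∈p; x∈∁p⇒x∉p; x∉p⇒x∈∁p; ∣∁p∣≡n∸∣p∣; ∪-∩-booleanAlgebra )
open import Data.List using (List; []; _∷_; map; _++_; length; filter)
open import Data.List.Properties using (filter-++; length-++)
open import Data.Nat using (ℕ; zero; suc; _+_; _*_; _∸_; _≤_; _≤?_; s≤s)
open import Data.Nat.Induction using (<-wellFounded)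
open import Data.Nat.Properties
  using (+-comm; +-identityʳ; ≰⇒>; <⇒≤; *-distribˡ-∸; ∸-monoʳ-≤; m+n∸m≡n; module ≤-Reasoning)
open import Data.Product using (Σ; ∃; _×_; _,_; proj₁; proj₂)
open import Data.Sum using (_⊎_; inj₁; inj₂; [_,_]′)
open import Data.Vec using ([]; _∷_)
open import Function using (_∘_; flip; id; _⇔_; mk⇔)
open import Induction.WellFounded using (WellFounded; Acc; acc; module Subrelation)
open import Relation.Binary.Construct.Closure.ReflexiveTransitive using (ε; _◅_)
import Relation.Binary.Construct.On as On
open import Relation.Binary.PropositionalEquality
  using (_≡_; _≢_; refl; sym; trans; cong; cong₂; subst; module ≡-Reasoning)
open import Relation.Nullary using (¬_; Dec; yes; no; contradiction)
open import Relation.Nullary.Decidable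
  using (_×-dec_; _⊎-dec_; _→-dec_; ¬?; map′; decidable-stable; does-⇔)

private
  variable
    n : ℕ
    F : Family n
    M P Q R S T W X Y Z Z′ : Subset n

∁-involutive : (X : Subset n) → ∁ (∁ X) ≡ X
∁-involutive {n} = BooleanAlgebra.¬-involutive (∪-∩-booleanAlgebra n)

∁≢⊥ : X ≢ ⊤ → ∁ X ≢ ⊥
∁≢⊥ {n} {X} X≢⊤ ∁X≡⊥ = X≢⊤ (begin
  X        ≡⟨ ∁-involutive X ⟨
  ∁ (∁ X)  ≡⟨ cong ∁ ∁X≡⊥ ⟩
  ∁ ⊥      ≡⟨ BooleanAlgebra.¬⊥≈⊤ (∪-∩-booleanAlgebra n) ⟩
  ⊤        ∎)
  where open ≡-Reasoning

∁≢⊤ : X ≢ ⊥ → ∁ X ≢ ⊤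
∁≢⊤ {n} {X} X≢⊥ ∁X≡⊤ = X≢⊥ (begin
  X        ≡⟨ ∁-involutive X ⟨
  ∁ (∁ X)  ≡⟨ cong ∁ ∁X≡⊤ ⟩
  ∁ ⊤      ≡⟨ BooleanAlgebra.¬⊤≈⊥ (∪-∩-booleanAlgebra n) ⟩
  ⊥        ∎)
  where open ≡-Reasoning

∁⊆⇒∁⊆ : ∁ X ⊆ Y → ∁ Y ⊆ X
∁⊆⇒∁⊆ ∁X⊆Y x∈∁Y = x∉∁p⇒x∈p (x∈∁p⇒x∉p x∈∁Y ∘ ∁X⊆Y)

⊆∁⇒⊆∁ : X ⊆ ∁ Y → Y ⊆ ∁ X
⊆∁⇒⊆∁ X⊆∁Y x∈Y = x∉p⇒x∈∁p (λ x∈X → x∈∁p⇒x∉p (X⊆∁Y x∈X) x∈Y)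

∪-least : X ⊆ Z → Y ⊆ Z → X ∪ Y ⊆ Z
∪-least {X = X} {Y = Y} X⊆Z Y⊆Z x∈X∪Y = [ X⊆Z , Y⊆Z ]′ (x∈p∪q⁻ X Y x∈X∪Y)

⊆∧⊉⇒⊂ : X ⊆ Y → ¬ Y ⊆ X → X ⊂ Y
⊆∧⊉⇒⊂ {n} {X} {Y} X⊆Y Y⊈X
  with ¬∀⟶∃¬ n (λ x → x ∈ Y → x ∈ X) (λ x → x ∈? Y →-dec x ∈? X) (λ Y⊆X → Y⊈X (Y⊆X _))
... | x , ¬[x∈Y→x∈X] = X⊆Y , x , x∈Y , x∉X
  where
  x∈Y : x ∈ Y
  x∈Y = decidable-stable (x ∈? Y) (λ x∉Y → ¬[x∈Y→x∈X] (λ x∈Y → contradiction x∈Y x∉Y))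
  x∉X : ¬ x ∈ X
  x∉X x∈X = ¬[x∈Y→x∈X] (λ _ → x∈X)

⊆⇒≡⊎⊂ : X ⊆ Y → Y ≡ X ⊎ X ⊂ Y
⊆⇒≡⊎⊂ {X = X} {Y} X⊆Y with Y ⊆? X
... | yes Y⊆X = inj₁ (⊆-antisym Y⊆X X⊆Y)
... | no Y⊈X  = inj₂ (⊆∧⊉⇒⊂ X⊆Y Y⊈X)

allSubset? : {P : Subset n → Set} → (∀ X → Dec (P X)) → Dec (∀ X → P X)
allSubset? P? = map′ (λ ∄¬P X → decidable-stable (P? X) (λ ¬PX → ∄¬P (X , ¬PX)))
                     (λ ∀P (X , ¬PX) → ¬PX (∀P X))
                     (¬? (anySubset? (¬? ∘ P?)))

comparable? : (X Y : Subset n) → Dec (Comparable X Y)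
comparable? X Y = X ⊆? Y ⊎-dec Y ⊆? X

comparable-sym : Comparable X Y → Comparable Y X
comparable-sym = [ inj₂ , inj₁ ]′

incomparable-sym : Incomparable X Y → Incomparable Y X
incomparable-sym (X⊈Y , Y⊈X) = Y⊈X , X⊈Y

comparable⇒¬incomparable : Comparable X Y → ¬ Incomparable X Y
comparable⇒¬incomparable (inj₁ X⊆Y) (X⊈Y , _) = X⊈Y X⊆Y
comparable⇒¬incomparable (inj₂ Y⊆X) (_ , Y⊈X) = Y⊈X Y⊆X

incomparable⇒≢⊥ : Incomparable X Y → X ≢ ⊥
incomparable⇒≢⊥ (X⊈Y , _) refl = X⊈Y ⊥⊆

incomparable⇒≢⊤ : Incomparable X Y → X ≢ ⊤
incomparable⇒≢⊤ (_ , Y⊈X) refl = Y⊈X ⊆⊤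

∁-comparable : Comparable X Y → Comparable (∁ X) (∁ Y)
∁-comparable = [ inj₂ ∘ p⊆q⇒∁p⊇∁q , inj₁ ∘ p⊆q⇒∁p⊇∁q ]′

∁-incomparable : Incomparable X Y → Incomparable (∁ X) (∁ Y)
∁-incomparable (X⊈Y , Y⊈X) = Y⊈X ∘ ∁p⊆∁q⇒p⊇q , X⊈Y ∘ ∁p⊆∁q⇒p⊇q

comparable-∁-swap : Comparable (∁ X) Y → Comparable X (∁ Y)
comparable-∁-swap = [ inj₂ ∘ ∁⊆⇒∁⊆ , inj₁ ∘ ⊆∁⇒⊆∁ ]′

Maximal : (Subset n → Set) → Subset n → Set
Maximal P X = ∀ {Y} → P Y → X ⊆ Y → Y ≡ X

Minimal : (Subset n → Set) → Subset n → Set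
Minimal P X = ∀ {Y} → P Y → Y ⊆ X → Y ≡ X

⊂-wellFounded : WellFounded (_⊂_ {n})
⊂-wellFounded = Subrelation.wellFounded p⊂q⇒∣p∣<∣q∣ (On.wellFounded ∣_∣ <-wellFounded)

⊃-wellFounded : WellFounded (flip (_⊂_ {n}))
⊃-wellFounded =
  Subrelation.wellFounded (p⊂q⇒∣p∣<∣q∣ ∘ p⊂q⇒∁p⊃∁q) (On.wellFounded (∣_∣ ∘ ∁) <-wellFounded)

module _ {P : Subset n → Set} (P? : ∀ X → Dec (P X)) where

  maximal-⊇ : P X → Σ (Subset n) λ Y → X ⊆ Y × P Y × Maximal P Y
  maximal-⊇ {X} = go (⊃-wellFounded X)
    where
    go : ∀ {X} → Acc (flip _⊂_) X → P X → Σ (Subset n) λ Y → X ⊆ Y × P Y × Maximal P Y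
    go {X} (acc larger) PX with anySubset? (λ Y → P? Y ×-dec X ⊂? Y)
    ... | yes (Y , PY , X⊂Y) = let Z , Y⊆Z , Z-maximal = go (larger X⊂Y) PY in
      Z , ⊆-trans (proj₁ X⊂Y) Y⊆Z , Z-maximal
    ... | no ∄larger =
      X , ⊆-refl , PX , λ PY X⊆Y →
        [ id , (λ X⊂Y → contradiction (_ , PY , X⊂Y) ∄larger) ]′ (⊆⇒≡⊎⊂ X⊆Y)

  minimal-⊆ : P X → Σ (Subset n) λ Y → Y ⊆ X × P Y × Minimal P Y
  minimal-⊆ {X} = go (⊂-wellFounded X)
    where
    go : ∀ {X} → Acc _⊂_ X → P X → Σ (Subset n) λ Y → Y ⊆ X × P Y × Minimal P Y
    go {X} (acc smaller) PX with anySubset? (λ Y → P? Y ×-dec Y ⊂? X)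
    ... | yes (Y , PY , Y⊂X) = let Z , Z⊆Y , Z-minimal = go (smaller Y⊂X) PY in
      Z , ⊆-trans Z⊆Y (proj₁ Y⊂X) , Z-minimal
    ... | no ∄smaller =
      X , ⊆-refl , PX , λ PY Y⊆X →
        [ sym , (λ Y⊂X → contradiction (_ , PY , Y⊂X) ∄smaller) ]′ (⊆⇒≡⊎⊂ Y⊆X)

∪-closed-maximal⇒greatest : {P : Subset n → Set} → (∀ {X Y} → P X → P Y → P (X ∪ Y)) →
  P X → Maximal P X → P Y → Y ⊆ X
∪-closed-maximal⇒greatest {X = X} {Y} ∪-closed PX X-maximal PY =
  subst (Y ⊆_) (X-maximal (∪-closed PX PY) (p⊆p∪q Y)) (q⊆p∪q X Y)

LowerBoundAbove : (Subset n → Set) → Subset n → Subset n → Set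
LowerBoundAbove P U S = ∀ Z → P Z → U ⊆ Z → S ⊆ Z

IsMeetAbove : (Subset n → Set) → Subset n → Subset n → Set
IsMeetAbove P U S = LowerBoundAbove P U S × (∀ {S′} → LowerBoundAbove P U S′ → S′ ⊆ S)

meet-above : {P : Subset n → Set} → (∀ X → Dec (P X)) → ∀ U →
  Σ (Subset n) λ S → U ⊆ S × IsMeetAbove P U S
meet-above {P = P} P? U =
  let S , U⊆S , S-lower , S-maximal = maximal-⊇ lowerBound? {X = U} (λ _ _ U⊆Z → U⊆Z)
  in S , U⊆S , S-lower , ∪-closed-maximal⇒greatest ∪-lower S-lower S-maximal
  where
  lowerBound? : ∀ S → Dec (LowerBoundAbove P U S)
  lowerBound? S = allSubset? λ Z → P? Z →-dec (U ⊆? Z →-dec S ⊆? Z)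
  ∪-lower : ∀ {S S′} → LowerBoundAbove P U S → LowerBoundAbove P U S′ → LowerBoundAbove P U (S ∪ S′)
  ∪-lower S-lower S′-lower Z PZ U⊆Z = ∪-least (S-lower Z PZ U⊆Z) (S′-lower Z PZ U⊆Z)

containsN-intro : P ∈F F → Q ∈F F → R ∈F F → S ∈F F → P ⊆ R → Q ⊆ R → Q ⊆ S →
  Incomparable P Q → Incomparable P S → Incomparable R S → ContainsN F
containsN-intro {P = P} {Q = Q} {R = R} {S = S} P∈F Q∈F R∈F S∈F P⊆R Q⊆R Q⊆S P∥Q P∥S R∥S =
  P , Q , R , S , (P∈F , Q∈F , R∈F , S∈F)
  , (P≢Q , P≢R , P≢S , Q≢R , Q≢S , R≢S)
  , (⊆∧⊉⇒⊂ P⊆R R⊈P , ⊆∧⊉⇒⊂ Q⊆R R⊈Q , ⊆∧⊉⇒⊂ Q⊆S S⊈Q)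
  , (P∥Q , P∥S , R∥S)
  where
  R⊈P : ¬ R ⊆ P
  R⊈P R⊆P = proj₂ P∥Q (⊆-trans Q⊆R R⊆P)
  R⊈Q : ¬ R ⊆ Q
  R⊈Q R⊆Q = proj₁ P∥Q (⊆-trans P⊆R R⊆Q)
  S⊈Q : ¬ S ⊆ Q
  S⊈Q S⊆Q = proj₂ R∥S (⊆-trans S⊆Q Q⊆R)
  P≢Q : P ≢ Q
  P≢Q refl = proj₁ P∥Q ⊆-refl
  P≢R : P ≢ R
  P≢R refl = R⊈P ⊆-refl
  P≢S : P ≢ S
  P≢S refl = proj₁ P∥S ⊆-refl
  Q≢R : Q ≢ R
  Q≢R refl = R⊈Q ⊆-refl
  Q≢S : Q ≢ S
  Q≢S refl = S⊈Q ⊆-refl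
  R≢S : R ≢ S
  R≢S refl = proj₁ R∥S ⊆-refl

containsN-≗ : {G : Family n} → (∀ X → F X ≡ G X) → ContainsN F → ContainsN G
containsN-≗ {F = F} {G = G} F≗G (P , Q , R , S , (P∈F , Q∈F , R∈F , S∈F) , shape) =
  P , Q , R , S , (move P∈F , move Q∈F , move R∈F , move S∈F) , shape
  where
  move : X ∈F F → X ∈F G
  move {X = X} = trans (sym (F≗G X))

-- Complementation reverses inclusion and N is self-dual: (P, Q, R, S) becomes (∁S, ∁R, ∁Q, ∁P).
containsN-∘∁ : ContainsN (F ∘ ∁) → ContainsN F
containsN-∘∁ (P , Q , R , S , (P∈ , Q∈ , R∈ , S∈) , _
               , ((P⊆R , _) , (Q⊆R , _) , (Q⊆S , _)) , (P∥Q , P∥S , R∥S)) =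
  containsN-intro S∈ R∈ Q∈ P∈ (p⊆q⇒∁p⊇∁q Q⊆S) (p⊆q⇒∁p⊇∁q Q⊆R) (p⊆q⇒∁p⊇∁q P⊆R)
    (∁-incomparable (incomparable-sym R∥S))
    (∁-incomparable (incomparable-sym P∥S))
    (∁-incomparable (incomparable-sym P∥Q))

ComparabilityClosed : Family n → Subset n → Set
ComparabilityClosed F T =
  ∀ {X Y} → Inner F X → Inner F Y → Comparable T X → Comparable X Y → Comparable T Y

hasseEdge⇒comparable : HasseEdge F X Y → Inner F Y × Comparable X Y
hasseEdge⇒comparable (inj₁ (_ , iY , (X⊆Y , _) , _)) = iY , inj₁ X⊆Y
hasseEdge⇒comparable (inj₂ (iY , _ , (Y⊆X , _) , _)) = iY , inj₂ Y⊆X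

comparable-along-path : ComparabilityClosed F T → Inner F X → Comparable T X → Connected F X Y →
  Comparable T Y
comparable-along-path closed iX T~X ε = T~X
comparable-along-path closed iX T~X (edge ◅ path) =
  let iZ , X~Z = hasseEdge⇒comparable edge in
  comparable-along-path closed iZ (closed iX iZ T~X X~Z) path

connected-isComponent : Inner F X → IsComponent F (Connected F X)
connected-isComponent {X = X} iX = X , iX , λ _ → id , id

inner? : (F : Family n) → ∀ X → Dec (Inner F X)
inner? F X = F X ≟ᵇ true ×-dec ¬? (X ≟S ⊥) ×-dec ¬? (X ≟S ⊤)

module _ {F : Family n} where

  ∈-insert⁻ : X ∈F insert T F → X ≡ T ⊎ X ∈F F
  ∈-insert⁻ {X = X} {T} X∈ with F X | X ≟S T
  ... | true  | _       = inj₂ refl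
  ... | false | yes X≡T = inj₁ X≡T
  ∈-insert⁻ () | false | no _

  ∈-insert-≢ : X ∈F insert T F → X ≢ T → X ∈F F
  ∈-insert-≢ X∈ X≢T = [ (λ X≡T → contradiction X≡T X≢T) , id ]′ (∈-insert⁻ X∈)

  inner-of-∈ : X ∈F F → Incomparable X Y → Inner F X
  inner-of-∈ X∈F X∥Y = X∈F , incomparable⇒≢⊥ X∥Y , incomparable⇒≢⊤ X∥Y

  N-insert⇒inner : ContainsN (insert T F) → ∃ (Inner F)
  N-insert⇒inner (P , Q , _ , _ , (P∈ , Q∈ , _) , (P≢Q , _) , _ , (P∥Q , _)) with ∈-insert⁻ P∈
  ... | inj₁ refl = Q , inner-of-∈ (∈-insert-≢ Q∈ (P≢Q ∘ sym)) (incomparable-sym P∥Q)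
  ... | inj₂ P∈F  = P , inner-of-∈ P∈F P∥Q

  -- Whichever member of the N is T, a chain of comparabilities inside the N leads from T
  -- to a member incomparable to T.
  closed⇒insert-N-free : ¬ ContainsN F → ComparabilityClosed F T → ¬ ContainsN (insert T F)
  closed⇒insert-N-free N-free closed
    (P , Q , R , S , (P∈ , Q∈ , R∈ , S∈) , (P≢Q , P≢R , P≢S , Q≢R , Q≢S , R≢S)
       , ((P⊆R , _) , (Q⊆R , _) , (Q⊆S , _)) , (P∥Q , P∥S , R∥S))
    with ∈-insert⁻ P∈ | ∈-insert⁻ Q∈ | ∈-insert⁻ R∈ | ∈-insert⁻ S∈
  ... | inj₁ refl | _ | _ | _ =
    comparable⇒¬incomparable (closed iQ iS (closed iR iQ (inj₁ P⊆R) (inj₂ Q⊆R)) (inj₁ Q⊆S)) P∥S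
    where
    iQ : Inner F Q
    iQ = inner-of-∈ (∈-insert-≢ Q∈ (P≢Q ∘ sym)) (incomparable-sym P∥Q)
    iR : Inner F R
    iR = inner-of-∈ (∈-insert-≢ R∈ (P≢R ∘ sym)) R∥S
    iS : Inner F S
    iS = inner-of-∈ (∈-insert-≢ S∈ (P≢S ∘ sym)) (incomparable-sym R∥S)
  ... | inj₂ P∈F | inj₁ refl | _ | _ =
    comparable⇒¬incomparable (comparable-sym (closed iR iP (inj₁ Q⊆R) (inj₂ P⊆R))) P∥Q
    where
    iP : Inner F P
    iP = inner-of-∈ P∈F P∥Q
    iR : Inner F R
    iR = inner-of-∈ (∈-insert-≢ R∈ (Q≢R ∘ sym)) R∥S
  ... | inj₂ _ | inj₂ Q∈F | inj₁ refl | _ =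
    comparable⇒¬incomparable (closed iQ iS (inj₂ Q⊆R) (inj₁ Q⊆S)) R∥S
    where
    iQ : Inner F Q
    iQ = inner-of-∈ Q∈F (incomparable-sym P∥Q)
    iS : Inner F S
    iS = inner-of-∈ (∈-insert-≢ S∈ (R≢S ∘ sym)) (incomparable-sym R∥S)
  ... | inj₂ P∈F | inj₂ Q∈F | inj₂ R∈F | inj₁ refl =
    comparable⇒¬incomparable
      (comparable-sym (closed iR iP (closed iQ iR (inj₂ Q⊆S) (inj₁ Q⊆R)) (inj₂ P⊆R))) P∥S
    where
    iP : Inner F P
    iP = inner-of-∈ P∈F P∥Q
    iQ : Inner F Q
    iQ = inner-of-∈ Q∈F (incomparable-sym P∥Q)
    iR : Inner F R
    iR = inner-of-∈ R∈F R∥S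
  ... | inj₂ P∈F | inj₂ Q∈F | inj₂ R∈F | inj₂ S∈F =
    N-free (containsN-intro P∈F Q∈F R∈F S∈F P⊆R Q⊆R Q⊆S P∥Q P∥S R∥S)

  closed⇒∈ : NSaturated F → ComparabilityClosed F T → T ∈F F
  closed⇒∈ {T = T} (N-free , saturated) closed with F T in F[T]
  ... | true  = refl
  ... | false = contradiction (saturated T F[T]) (closed⇒insert-N-free N-free closed)

inner-exists : {F : Family n} → 2 ≤ n → NSaturated F → ∃ (Inner F)
inner-exists {F = F} (s≤s (s≤s _)) (_ , saturated) with F ⁅ zero ⁆ in F[⁅0⁆]
... | true  = ⁅ zero ⁆ , F[⁅0⁆] , (λ ()) , (λ ())
... | false = N-insert⇒inner (saturated ⁅ zero ⁆ F[⁅0⁆])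

module ClosedSetConstruction {F : Family n} (N-free : ¬ ContainsN F)
  {a : Subset n} (a-inner : Inner F a) (a-minimal : Minimal (Inner F) a) where

  Above : Subset n → Set
  Above X = Inner F X × a ⊆ X

  Below : Subset n → Set
  Below X = ∃ λ Z → Above Z × X ⊆ Z

  Candidate : Subset n → Set
  Candidate T = a ⊆ T × (∀ Z → Above Z → Comparable Z T) × Below T

  above? : ∀ X → Dec (Above X)
  above? X = inner? F X ×-dec a ⊆? X

  candidate? : ∀ T → Dec (Candidate T)
  candidate? T =
    a ⊆? T
      ×-dec allSubset? (λ Z → above? Z →-dec comparable? Z T)
      ×-dec anySubset? (λ Z → above? Z ×-dec T ⊆? Z)

  candidate-a : Candidate a
  candidate-a = ⊆-refl , (λ _ (_ , a⊆Z) → inj₂ a⊆Z) , (a , (a-inner , ⊆-refl) , ⊆-refl)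

  inner-⊉a⇒∥a : Inner F W → ¬ a ⊆ W → Incomparable W a
  inner-⊉a⇒∥a iW a⊈W = (λ W⊆a → a⊈W (⊆-reflexive (sym (a-minimal iW W⊆a)))) , a⊈W

  below-closed : Inner F X → Inner F Y → Below X → Comparable X Y → Below Y
  below-closed iX iY (Z , Z-above , X⊆Z) (inj₂ Y⊆X) = Z , Z-above , ⊆-trans Y⊆X X⊆Z
  below-closed iX iY (Z , Z-above@(iZ , a⊆Z) , X⊆Z) (inj₁ X⊆Y) with a ⊆? _ | _ ⊆? Z
  ... | yes a⊆Y | _       = _ , (iY , a⊆Y) , ⊆-refl
  ... | no _    | yes Y⊆Z = Z , Z-above , Y⊆Z
  ... | no a⊈Y  | no Y⊈Z  =
    ⊥-elim (N-free (containsN-intro (proj₁ a-inner) (proj₁ iX) (proj₁ iZ) (proj₁ iY) a⊆Z X⊆Z X⊆Y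
      (incomparable-sym (inner-⊉a⇒∥a iX (λ a⊆X → a⊈Y (⊆-trans a⊆X X⊆Y))))
      (incomparable-sym (inner-⊉a⇒∥a iY a⊈Y))
      ((λ Z⊆Y → a⊈Y (⊆-trans a⊆Z Z⊆Y)) , Y⊈Z)))

  nested-above : Inner F W → ¬ a ⊆ W → Above Z → Above Z′ → W ⊆ Z′ → ¬ W ⊆ Z → Z ⊆ Z′
  nested-above {Z = Z} {Z′ = Z′} iW a⊈W (iZ , a⊆Z) (iZ′ , a⊆Z′) W⊆Z′ W⊈Z with Z ⊆? Z′ | Z′ ⊆? Z
  ... | yes Z⊆Z′ | _        = Z⊆Z′
  ... | no _     | yes Z′⊆Z = ⊥-elim (W⊈Z (⊆-trans W⊆Z′ Z′⊆Z))
  ... | no Z⊈Z′  | no Z′⊈Z  =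
    ⊥-elim (N-free (containsN-intro (proj₁ iW) (proj₁ a-inner) (proj₁ iZ′) (proj₁ iZ) W⊆Z′ a⊆Z′ a⊆Z
      (inner-⊉a⇒∥a iW a⊈W) (W⊈Z , λ Z⊆W → a⊈W (⊆-trans a⊆Z Z⊆W)) (Z′⊈Z , Z⊈Z′)))

  module MaximalCandidate {T : Subset n} (T-candidate : Candidate T) (T-maximal : Maximal Candidate T) where

    a⊆T : a ⊆ T
    a⊆T = proj₁ T-candidate

    T-comparable : ∀ Z → Above Z → Comparable Z T
    T-comparable = proj₁ (proj₂ T-candidate)

    T-below : Below T
    T-below = proj₂ (proj₂ T-candidate)

    meet-candidate : Inner F W → Below W → Incomparable W T → T ∪ W ⊆ S → IsMeetAbove Above (T ∪ W) S →
      Candidate S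
    meet-candidate {W = W} {S = S} iW (Z₀ , Z₀-above , W⊆Z₀) W∥T T∪W⊆S (S-lower , S-greatest) =
      ⊆-trans a⊆T T⊆S , S-comparable , (Z₀ , Z₀-above , S-lower Z₀ Z₀-above (∪-least T⊆Z₀ W⊆Z₀))
      where
      T⊆S : T ⊆ S
      T⊆S = ⊆-trans (p⊆p∪q W) T∪W⊆S
      T⊆Z₀ : T ⊆ Z₀
      T⊆Z₀ with T-comparable Z₀ Z₀-above
      ... | inj₁ Z₀⊆T = ⊥-elim (proj₁ W∥T (⊆-trans W⊆Z₀ Z₀⊆T))
      ... | inj₂ T⊆Z₀ = T⊆Z₀
      a⊈W : ¬ a ⊆ W
      a⊈W a⊆W = comparable⇒¬incomparable (T-comparable W (iW , a⊆W)) W∥T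
      S-comparable : ∀ Z → Above Z → Comparable Z S
      S-comparable Z Z-above with T ∪ W ⊆? Z | T-comparable Z Z-above
      ... | yes T∪W⊆Z | _        = inj₂ (S-lower Z Z-above T∪W⊆Z)
      ... | no _      | inj₁ Z⊆T = inj₁ (⊆-trans Z⊆T T⊆S)
      ... | no T∪W⊈Z  | inj₂ T⊆Z = inj₁ (S-greatest λ Z′ Z′-above T∪W⊆Z′ →
        nested-above iW a⊈W Z-above Z′-above (⊆-trans (q⊆p∪q T W) T∪W⊆Z′)
          (λ W⊆Z → T∪W⊈Z (∪-least T⊆Z W⊆Z)))

    below⇒comparable : Inner F W → Below W → Comparable W T
    below⇒comparable {W = W} iW W-below with W ⊆? T | T ⊆? W
    ... | yes W⊆T | _       = inj₁ W⊆T
    ... | no _    | yes T⊆W = inj₂ T⊆W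
    ... | no W⊈T  | no T⊈W  =
      let S , T∪W⊆S , S-meet = meet-above above? (T ∪ W)
          S≡T = T-maximal (meet-candidate iW W-below (W⊈T , T⊈W) T∪W⊆S S-meet)
                          (⊆-trans (p⊆p∪q W) T∪W⊆S)
      in ⊥-elim (W⊈T (subst (W ⊆_) S≡T (⊆-trans (q⊆p∪q T W) T∪W⊆S)))

    closed : ComparabilityClosed F T
    closed {X} iX iY T~X X~Y = comparable-sym (below⇒comparable iY (below-closed iX iY (X-below T~X) X~Y))
      where
      X-below : Comparable T X → Below X
      X-below (inj₁ T⊆X) = X , (iX , ⊆-trans a⊆T T⊆X) , ⊆-refl
      X-below (inj₂ X⊆T) = let Z , Z-above , T⊆Z = T-below in Z , Z-above , ⊆-trans X⊆T T⊆Z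

    T≢⊥ : T ≢ ⊥
    T≢⊥ refl = proj₁ (proj₂ a-inner) (⊆-antisym a⊆T ⊥⊆)

    T≢⊤ : T ≢ ⊤
    T≢⊤ refl = let Z , ((_ , _ , Z≢⊤) , _) , ⊤⊆Z = T-below in Z≢⊤ (⊆-antisym ⊆⊤ ⊤⊆Z)

closed-inner-exists : {F : Family n} → 2 ≤ n → NSaturated F → ∃ λ T → Inner F T × ComparabilityClosed F T
closed-inner-exists {F = F} 2≤n saturated =
  let X , iX = inner-exists 2≤n saturated
      a , _ , a-inner , a-minimal = minimal-⊆ (inner? F) iX
      open ClosedSetConstruction (proj₁ saturated) a-inner a-minimal
      T , _ , T-candidate , T-maximal = maximal-⊇ candidate? candidate-a
      open MaximalCandidate T-candidate T-maximal
  in T , (closed⇒∈ saturated closed , T≢⊥ , T≢⊤) , closed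

inner-∘∁ : Inner F X → Inner (F ∘ ∁) (∁ X)
inner-∘∁ {F = F} {X} (X∈F , X≢⊥ , X≢⊤) =
  subst (_∈F F) (sym (∁-involutive X)) X∈F , ∁≢⊥ X≢⊤ , ∁≢⊤ X≢⊥

inner-∘∁⁻ : Inner (F ∘ ∁) X → Inner F (∁ X)
inner-∘∁⁻ (∁X∈F , X≢⊥ , X≢⊤) = ∁X∈F , ∁≢⊥ X≢⊤ , ∁≢⊤ X≢⊥

closed-∘∁ : ComparabilityClosed F T → ComparabilityClosed (F ∘ ∁) (∁ T)
closed-∘∁ {F = F} closed iX iY ∁T~X X~Y =
  comparable-sym (comparable-∁-swap (comparable-sym
    (closed (inner-∘∁⁻ {F = F} iX) (inner-∘∁⁻ {F = F} iY) (comparable-∁-swap ∁T~X) (∁-comparable X~Y))))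

insert-∁ : ∀ X (F : Family n) Y → insert (∁ X) F Y ≡ insert X (F ∘ ∁) (∁ Y)
insert-∁ X F Y = cong₂ _∨_ (cong F (sym (∁-involutive Y))) (does-⇔ swap (Y ≟S ∁ X) (∁ Y ≟S X))
  where
  swap : Y ≡ ∁ X ⇔ ∁ Y ≡ X
  swap = mk⇔ (λ Y≡∁X → trans (cong ∁ Y≡∁X) (∁-involutive X))
             (λ ∁Y≡X → trans (sym (∁-involutive Y)) (cong ∁ ∁Y≡X))

∘∁-saturated : NSaturated F → NSaturated (F ∘ ∁)
∘∁-saturated (N-free , saturated) =
  N-free ∘ containsN-∘∁ ,
  λ X X∉ → containsN-∘∁ (containsN-≗ (insert-∁ X _) (saturated (∁ X) X∉))

count : {A : Set} → (A → Bool) → List A → ℕ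
count p xs = length (filter (λ x → p x ≟ᵇ true) xs)

count-++ : {A : Set} (p : A → Bool) (xs ys : List A) → count p (xs ++ ys) ≡ count p xs + count p ys
count-++ p xs ys = trans (cong length (filter-++ (λ x → p x ≟ᵇ true) xs ys)) (length-++ (filter _ xs))

count-map : {A B : Set} (p : B → Bool) (f : A → B) (xs : List A) → count p (map f xs) ≡ count (p ∘ f) xs
count-map p f []       = refl
count-map p f (x ∷ xs) with p (f x)
... | true  = cong suc (count-map p f xs)
... | false = count-map p f xs

card-∘∁ : (F : Family n) → card (F ∘ ∁) ≡ card F
card-∘∁ {zero}  F with F []
... | true  = refl
... | false = refl
card-∘∁ {suc n} F = begin
  count (F ∘ ∁) (map (inside ∷_) A ++ map (outside ∷_) A)
    ≡⟨ count-++ (F ∘ ∁) (map (inside ∷_) A) (map (outside ∷_) A) ⟩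
  count (F ∘ ∁) (map (inside ∷_) A) + count (F ∘ ∁) (map (outside ∷_) A)
    ≡⟨ cong₂ _+_ (count-map (F ∘ ∁) (inside ∷_) A) (count-map (F ∘ ∁) (outside ∷_) A) ⟩
  card (Fₒ ∘ ∁) + card (Fᵢ ∘ ∁)
    ≡⟨ cong₂ _+_ (card-∘∁ Fₒ) (card-∘∁ Fᵢ) ⟩
  card Fₒ + card Fᵢ
    ≡⟨ +-comm (card Fₒ) (card Fᵢ) ⟩
  card Fᵢ + card Fₒ
    ≡⟨ cong₂ _+_ (count-map F (inside ∷_) A) (count-map F (outside ∷_) A) ⟨
  count F (map (inside ∷_) A) + count F (map (outside ∷_) A)
    ≡⟨ count-++ F (map (inside ∷_) A) (map (outside ∷_) A) ⟨
  card F ∎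
  where
  open ≡-Reasoning
  A = allSubsets n
  Fᵢ Fₒ : Family n
  Fᵢ X = F (inside ∷ X)
  Fₒ X = F (outside ∷ X)

closed-component : {F : Family n} → Inner F M → ComparabilityClosed F M → 2 * ∣ M ∣ ≤ n →
  Σ (Subset n → Set) λ G → IsComponent F G ×
    Σ (Subset n) λ M′ → G M′ × 2 * ∣ M′ ∣ ≤ n × ((Y : Subset n) → G Y → Comparable M′ Y)
closed-component {M = M} M-inner M-closed small =
  Connected _ M , connected-isComponent M-inner , M , ε , small ,
  λ _ → comparable-along-path M-closed M-inner (inj₁ ⊆-refl)

n≤2t⇒2[n∸t]≤n : ∀ n t → n ≤ 2 * t → 2 * (n ∸ t) ≤ n
n≤2t⇒2[n∸t]≤n n t n≤2t = begin
  2 * (n ∸ t)      ≡⟨ *-distribˡ-∸ 2 n t ⟩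
  2 * n ∸ 2 * t    ≤⟨ ∸-monoʳ-≤ (2 * n) n≤2t ⟩
  n + (n + 0) ∸ n  ≡⟨ m+n∸m≡n n (n + 0) ⟩
  n + 0            ≡⟨ +-identityʳ n ⟩
  n                ∎
  where open ≤-Reasoning

lemma3p4 : (n : ℕ) → 2 ≤ n → (F : Family n) → NSaturated F →
    Σ (Family n) λ F′ → NSaturated F′ × card F′ ≡ card F ×
      Σ (Subset n → Set) λ G′ → IsComponent F′ G′ ×
        Σ (Subset n) λ M′ → G′ M′ × 2 * ∣ M′ ∣ ≤ n × ((Y : Subset n) → G′ Y → Comparable M′ Y)
lemma3p4 n 2≤n F saturated with closed-inner-exists 2≤n saturated
... | T , T-inner , T-closed with 2 * ∣ T ∣ ≤? n
...   | yes small = F , saturated , refl , closed-component T-inner T-closed small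
...   | no large  =
  F ∘ ∁ , ∘∁-saturated saturated , card-∘∁ F ,
  closed-component (inner-∘∁ {F = F} T-inner) (closed-∘∁ T-closed) ∣∁T∣-small
  where
  ∣∁T∣-small : 2 * ∣ ∁ T ∣ ≤ n
  ∣∁T∣-small rewrite ∣∁p∣≡n∸∣p∣ T = n≤2t⇒2[n∸t]≤n n ∣ T ∣ (<⇒≤ (≰⇒> large))
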